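{- Let $n\in\mathbb{N}=\{0,1,2,\ldots\}$ and $g_2(x,y,z)=2x^2+8y^2+15z^2-2xy$. Assume that $15n+8=g_2(x,y,z)$ for some $x,y,z\in\mathbb{Z}$ with $y^2+z^2\neq0$. Then $15n+8=g_2(u,v,w)$ for some $u,v,w\in\mathbb{Z}$ with $3\nmid v+w$. -}

module Defs where

open import Data.Integer using (ℤ; _+_; _*_; _-_; +_)

g₂ : ℤ → ℤ → ℤ → ℤ
g₂ x y z = + 2 * (x * x) + + 8 * (y * y) + + 15 * (z * z) - + 2 * (x * y)

{-# OPTIONS --safe #-}
-- Since 2 g₂(x,y,z) = (2x − y)² + 15 (y² + 2z²), the value of g₂ only depends on
-- 2x − y and on the norm y² + 2z² of y + z√−2; so (y, z) may be replaced by any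
-- (y + 2t, w) of the same norm, with x replaced by x + t.  If 3 divides neither
-- y + z nor y − z, then (y, z) or (y, −z) already works.  Otherwise 3 divides y and z,
-- and we descend to (y/3, z/3) and multiply a good pair for it by −1 + 2√−2, which has
-- norm 9, preserves parity of the first coordinate and the residue of the sum mod 3.
module Submission where

open import Defs
open import Data.Nat using (ℕ)
open import Data.Integer using (ℤ; _+_; _*_; +_)
open import Data.Integer.Divisibility using (_∣_)
open import Data.Product using (∃-syntax; _×_)
open import Relation.Nullary using (¬_)
open import Relation.Binary.PropositionalEquality using (_≡_; _≢_)

open import Data.Integer using (_-_; -_; ∣_∣)
import Data.Nat as ℕ
import Data.Nat.Properties as ℕ
import Data.Integer.Properties as ℤ
open import Data.Integer.Divisibility.Signed
  using (divides; ∣ᵤ⇒∣; _∣?_; ∣-refl; ∣m∣n⇒∣m+n; ∣m⇒∣m*n)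
  renaming (_∣_ to _∣ₛ_)
open import Data.Integer.Tactic.RingSolver using (solve-∀; solve)
open import Data.List using (_∷_; [])
open import Data.Nat.Induction using (<-wellFounded)
open import Induction.WellFounded using (Acc; acc)
open import Data.Product using (_,_)
open import Function using (_∘_)
open import Relation.Nullary using (yes; no)
open import Relation.Binary.PropositionalEquality using (refl; sym; trans; cong; cong₂; subst; module ≡-Reasoning)

norm : ℤ → ℤ → ℤ
norm a b = a * a + + 2 * (b * b)

g₂-double : ∀ x y z → + 2 * g₂ x y z ≡ (+ 2 * x - y) * (+ 2 * x - y) + + 15 * norm y z
g₂-double = identity
  where
  identity : ∀ x y z →
    + 2 * (+ 2 * (x * x) + + 8 * (y * y) + + 15 * (z * z) - + 2 * (x * y))
      ≡ (+ 2 * x - y) * (+ 2 * x - y) + + 15 * (y * y + + 2 * (z * z))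
  identity = solve-∀

g₂-shift : ∀ x y z t w → norm (y + + 2 * t) w ≡ norm y z → g₂ (x + t) (y + + 2 * t) w ≡ g₂ x y z
g₂-shift x y z t w eq = ℤ.*-cancelˡ-≡ (+ 2) _ _ (begin
  + 2 * g₂ (x + t) (y + + 2 * t) w
    ≡⟨ g₂-double (x + t) (y + + 2 * t) w ⟩
  (+ 2 * (x + t) - (y + + 2 * t)) * (+ 2 * (x + t) - (y + + 2 * t)) + + 15 * norm (y + + 2 * t) w
    ≡⟨ cong₂ (λ c m → c * c + + 15 * m) (shift-cancels x y t) eq ⟩
  (+ 2 * x - y) * (+ 2 * x - y) + + 15 * norm y z
    ≡⟨ sym (g₂-double x y z) ⟩
  + 2 * g₂ x y z ∎)
  where
  open ≡-Reasoning
  shift-cancels : ∀ x y t → + 2 * (x + t) - (y + + 2 * t) ≡ + 2 * x - y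
  shift-cancels = solve-∀

record Rebalanced (a b : ℤ) : Set where
  constructor rebalanced
  field
    shift     : ℤ
    partner   : ℤ
    same-norm : norm (a + + 2 * shift) partner ≡ norm a b
    3∤sum     : ¬ (+ 3 ∣ₛ (a + + 2 * shift) + partner)

3∤a+b⇒rebalanced : ∀ {a b} → ¬ (+ 3 ∣ₛ a + b) → Rebalanced a b
3∤a+b⇒rebalanced {a} {b} 3∤a+b =
  rebalanced (+ 0) b (cong (λ c → norm c b) a+0≡a) (subst (λ c → ¬ (+ 3 ∣ₛ c + b)) (sym a+0≡a) 3∤a+b)
  where
  a+0≡a : a + + 0 ≡ a
  a+0≡a = ℤ.+-identityʳ a

rebalanced-neg : ∀ {a b} → Rebalanced a (- b) → Rebalanced a b
rebalanced-neg {a} {b} (rebalanced t w eq 3∤) = rebalanced t w (trans eq (norm-neg a b)) 3∤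
  where
  norm-neg : ∀ a b → a * a + + 2 * (- b * - b) ≡ a * a + + 2 * (b * b)
  norm-neg = solve-∀

norm-scale : ∀ k a b → k * k * norm a b ≡ norm (a * k) (b * k)
norm-scale = identity
  where
  identity : ∀ k a b → k * k * (a * a + + 2 * (b * b)) ≡ (a * k) * (a * k) + + 2 * ((b * k) * (b * k))
  identity = solve-∀

-- Multiplication by −1 + 2√−2 in ℤ[√−2].
norm-mul-9 : ∀ a b → norm (- a - + 4 * b) (+ 2 * a - b) ≡ + 9 * norm a b
norm-mul-9 = identity
  where
  identity : ∀ a b →
    (- a - + 4 * b) * (- a - + 4 * b) + + 2 * ((+ 2 * a - b) * (+ 2 * a - b))
      ≡ + 9 * (a * a + + 2 * (b * b))
  identity = solve-∀

rebalanced-*3 : ∀ {a b} → Rebalanced a b → Rebalanced (a * + 3) (b * + 3)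
rebalanced-*3 {a} {b} (rebalanced t w eq 3∤) =
  rebalanced t′ w′
    (trans (cong (λ c → norm c w′) 3a+2t′≡) norm-eq)
    (3∤′ ∘ subst (+ 3 ∣ₛ_) (cong (_+ w′) 3a+2t′≡))
  where
  open ≡-Reasoning
  a′ t′ w′ : ℤ
  a′ = a + + 2 * t
  t′ = - (+ 2 * a) - t - + 2 * w
  w′ = + 2 * a′ - w

  3a+2t′≡ : a * + 3 + + 2 * (- (+ 2 * a) - t - + 2 * w) ≡ - (a + + 2 * t) - + 4 * w
  3a+2t′≡ = solve (a ∷ t ∷ w ∷ [])

  norm-eq : norm (- a′ - + 4 * w) w′ ≡ norm (a * + 3) (b * + 3)
  norm-eq = begin
    norm (- a′ - + 4 * w) w′ ≡⟨ norm-mul-9 a′ w ⟩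
    + 9 * norm a′ w          ≡⟨ cong (+ 9 *_) eq ⟩
    + 9 * norm a b           ≡⟨ norm-scale (+ 3) a b ⟩
    norm (a * + 3) (b * + 3) ∎

  3∤′ : ¬ (+ 3 ∣ₛ (- a′ - + 4 * w) + w′)
  3∤′ 3∣ = 3∤ (subst (+ 3 ∣ₛ_) (sum-shift a′ w) (∣m∣n⇒∣m+n 3∣ (∣m⇒∣m*n (+ 2 * w) ∣-refl)))
    where
    sum-shift : ∀ a w → (- a - + 4 * w) + (+ 2 * a - w) + + 3 * (+ 2 * w) ≡ a + w
    sum-shift = solve-∀

3∣a±b⇒3∣a,b : ∀ {a b} → + 3 ∣ₛ a + b → + 3 ∣ₛ a - b → ∃[ a₁ ] ∃[ b₁ ] ((a ≡ a₁ * + 3) × (b ≡ b₁ * + 3))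
3∣a±b⇒3∣a,b {a} {b} (divides p a+b≡p3) (divides q a-b≡q3) = a - p - q , + 2 * p + q - a , a≡ , b≡
  where
  open ≡-Reasoning
  a≡ : a ≡ (a - p - q) * + 3
  a≡ = begin
    a                               ≡⟨ solve (a ∷ b ∷ []) ⟩
    + 3 * a - (a + b) - (a - b)     ≡⟨ cong₂ (λ m n → + 3 * a - m - n) a+b≡p3 a-b≡q3 ⟩
    + 3 * a - p * + 3 - q * + 3     ≡⟨ solve (a ∷ p ∷ q ∷ []) ⟩
    (a - p - q) * + 3               ∎
  b≡ : b ≡ (+ 2 * p + q - a) * + 3
  b≡ = begin
    b                                   ≡⟨ solve (a ∷ b ∷ []) ⟩
    + 2 * (a + b) + (a - b) - + 3 * a   ≡⟨ cong₂ (λ m n → + 2 * m + n - + 3 * a) a+b≡p3 a-b≡q3 ⟩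
    + 2 * (p * + 3) + q * + 3 - + 3 * a ≡⟨ solve (a ∷ p ∷ q ∷ []) ⟩
    (+ 2 * p + q - a) * + 3             ∎

size : ℤ → ℤ → ℕ
size a b = ∣ a ∣ ℕ.+ ∣ b ∣

size-* : ∀ a b k → size (a * k) (b * k) ≡ size a b ℕ.* ∣ k ∣
size-* a b k rewrite ℤ.abs-* a k | ℤ.abs-* b k = sym (ℕ.*-distribʳ-+ (∣ k ∣) (∣ a ∣) (∣ b ∣))

a²+b²≢0⇒size≢0 : ∀ a b → a * a + b * b ≢ + 0 → size a b ≢ 0
a²+b²≢0⇒size≢0 a b a²+b²≢0 size≡0
  with ℤ.∣i∣≡0⇒i≡0 {a} (ℕ.m+n≡0⇒m≡0 ∣ a ∣ size≡0) | ℤ.∣i∣≡0⇒i≡0 {b} (ℕ.m+n≡0⇒n≡0 ∣ a ∣ size≡0)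
... | refl | refl = a²+b²≢0 refl

rebalance-acc : ∀ a b → Acc ℕ._<_ (size a b) → size a b ≢ 0 → Rebalanced a b
rebalance-acc a b (acc smaller) size≢0 with + 3 ∣? a + b | + 3 ∣? a - b
... | no 3∤a+b | _        = 3∤a+b⇒rebalanced 3∤a+b
... | yes _    | no 3∤a-b = rebalanced-neg (3∤a+b⇒rebalanced 3∤a-b)
... | yes 3∣a+b | yes 3∣a-b with 3∣a±b⇒3∣a,b {a} {b} 3∣a+b 3∣a-b
...   | a₁ , b₁ , refl , refl = rebalanced-*3 (rebalance-acc a₁ b₁ (smaller size₁<size) size₁≢0)
  where
  size₁≢0 : size a₁ b₁ ≢ 0
  size₁≢0 size₁≡0 = size≢0 (trans (size-* a₁ b₁ (+ 3)) (cong (ℕ._* 3) size₁≡0))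
  size₁<size : size a₁ b₁ ℕ.< size (a₁ * + 3) (b₁ * + 3)
  size₁<size = subst (size a₁ b₁ ℕ.<_) (sym (size-* a₁ b₁ (+ 3)))
    (ℕ.m<m*n (size a₁ b₁) 3 ⦃ ℕ.≢-nonZero size₁≢0 ⦄ (ℕ.s≤s (ℕ.s≤s ℕ.z≤n)))

rebalance : ∀ a b → size a b ≢ 0 → Rebalanced a b
rebalance a b = rebalance-acc a b (<-wellFounded (size a b))

lemma5p5 : (n : ℕ) →
    (∃[ x ] ∃[ y ] ∃[ z ] ((+ (15 Data.Nat.* n Data.Nat.+ 8) ≡ g₂ x y z) × (y * y + z * z ≢ + 0))) →
    ∃[ u ] ∃[ v ] ∃[ w ] ((+ (15 Data.Nat.* n Data.Nat.+ 8) ≡ g₂ u v w) × ¬ (+ 3 ∣ v + w))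
lemma5p5 n (x , y , z , 15n+8≡g₂ , y²+z²≢0) with rebalance y z (a²+b²≢0⇒size≢0 y z y²+z²≢0)
... | rebalanced t w same-norm 3∤ =
  x + t , y + + 2 * t , w , trans 15n+8≡g₂ (sym (g₂-shift x y z t w same-norm)) , λ 3∣ → 3∤ (∣ᵤ⇒∣ 3∣)
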